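{- Let $1\leq r\leq n$ and $p,q\geq 2$ be integers. If the set $D_r(\mathcal T_n)=\{f\in\mathcal T_n:\operatorname{rank}(f)=r\}$ contains a subsemigroup isomorphic to a $p\times q$ rectangular band, then with $l=\lceil\log_r p\rceil$ we have $\pi_r(n-l)\geq q$.
   Context: $\mathcal T_n$ is the full transformation semigroup on $\{1,\dots,n\}$; the rank of a transformation is the size of its image. A $p\times q$ rectangular band is a semigroup $P\times Q$ with $|P|=p$, $|Q|=q$ and $(p_1,q_1)(p_2,q_2)=(p_1,q_2)$. For $1\leq r\leq m$, $\pi_r(m)$ is the maximum of $s_1\cdots s_r$ over all $r$-tuples of positive integers with $s_1+\cdots+s_r=m$ (the inequality $\pi_r(m)\geq q$ is understood to fail if $m<r$). -}

module Defs where

open import Data.Nat using (ℕ; zero; suc; _+_; _*_; _^_; _≤_; _<_; _≥_)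
open import Data.Fin using (Fin)
open import Data.Fin.Properties using (any?; _≟_)
open import Data.Vec using (Vec; allFin; count; foldr)
open import Data.Vec.Relation.Unary.All using (All)
open import Data.Product using (Σ; ∃; _×_; _,_)
open import Data.Sum using (_⊎_)
open import Relation.Binary.PropositionalEquality using (_≡_)

T : ℕ → Set
T n = Fin n → Fin n

-- Semigroup product, transformations acting on the right: x (f·g) = (x f) g.
_·_ : ∀ {n} → T n → T n → T n
(f · g) x = g (f x)

_≈_ : ∀ {n} → T n → T n → Set
f ≈ g = ∀ x → f x ≡ g x

rank : ∀ {n} → T n → ℕ
rank {n} f = count (λ y → any? (λ x → f x ≟ y)) (allFin n)

_⋆_ : ∀ {p q} → Fin p × Fin q → Fin p × Fin q → Fin p × Fin q
(p₁ , _) ⋆ (_ , q₂) = (p₁ , q₂)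

-- D_r(T_n) contains a subsemigroup isomorphic to the p × q rectangular band:
-- an injective homomorphism φ from the band into T_n with all values of rank r
-- (its image is then a subsemigroup contained in D_r, isomorphic to the band).
HasRectBand : (n r p q : ℕ) → Set
HasRectBand n r p q =
  Σ (Fin p × Fin q → T n) λ φ →
    (∀ a → rank (φ a) ≡ r) ×
    (∀ a b → φ (a ⋆ b) ≈ (φ a · φ b)) ×
    (∀ a b → φ a ≈ φ b → a ≡ b)

IsCeilLog : (r p l : ℕ) → Set
IsCeilLog r p l = p ≤ r ^ l × (∀ k → p ≤ r ^ k → l ≤ k)

prod : ∀ {k} → Vec ℕ k → ℕ
prod = foldr _ _*_ 1

sumV : ∀ {k} → Vec ℕ k → ℕ
sumV = foldr _ _+_ 0

-- π_r(m) ≥ q : the maximum of s₁⋯s_r over r-tuples of positive integers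
-- with s₁+⋯+s_r = m is at least q, i.e. some such tuple has product ≥ q.
-- (Fails automatically when m < r, since no such tuple exists.)
PiGeq : (r m q : ℕ) → Set
PiGeq r m q = ∃ λ (s : Vec ℕ r) → All (λ x → 1 ≤ x) s × sumV s ≡ m × q ≤ prod s

-- Fix an embedded band with idempotents e i j, so that e i j ; e k l = e i l, and put h = e i₀ j₀,
-- a transformation of rank r with image I. The maps g i = e i j₀ take values in I and coincide with
-- h outside a set C of points; since they are pairwise distinct they are determined by their
-- restrictions C → I, whence p ≤ r ^ |C| and l ≤ |C|. The maps c j = e i₀ j factor through h, and
-- c j sends each t ∈ I into the fibre F t of h restricted to the complement of C; being pairwise
-- distinct, they give q ≤ ∏_{t ∈ I} |F t|. The r nonempty fibres F t have total size n − |C| ≤ n − l.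
module Submission where

open import Defs
open import Data.Nat using (ℕ; _≤_; _∸_)
open import Data.Nat.Base using (suc; _+_; _*_; _^_; z≤n; s≤s)
open import Data.Nat.Properties
  using (+-0-commutativeMonoid; ≤-trans; ≤-reflexive; m≤m+n; +-monoˡ-≤; *-monoˡ-≤;
         +-comm; +-assoc; +-suc; +-monoʳ-≤; m≤n+m; m+[n∸m]≡n; m+n≤o⇒m≤o∸n; ∸-monoʳ-≤; module ≤-Reasoning)
open import Data.Nat.ListAction using (sum; product)
open import Data.Bool.Base using (if_then_else_)
open import Data.Fin.Base as Fin using (Fin)
open import Data.Fin.Properties using (any?; all?; _≟_; injective⇒≤)
open import Data.List.Base as List
  using (List; []; _∷_; [_]; map; filter; length; lookup; tabulate; allFin; cartesianProductWith)
open import Data.List.Properties using (length-++; length-map; length-tabulate; map-∘; map-tabulate; ∷-injective)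
open import Data.List.Membership.Propositional using (_∈_)
open import Data.List.Membership.Propositional.Properties
  using (∈-allFin; ∈-filter⁺; ∈-filter⁻; ∈-cartesianProductWith⁺; ∈-length)
open import Data.List.Relation.Unary.All as All using (All; []; _∷_)
open import Data.List.Relation.Unary.All.Properties using (map⁺)
open import Data.List.Relation.Unary.Any using (here; index)
open import Data.List.Relation.Unary.Any.Properties using (lookup-index)
open import Data.Vec.Base as Vec using (count; fromList)
import Data.Vec.Relation.Unary.All.Properties as VecAll
open import Data.Product using (_×_; _,_; proj₁; proj₂)
open import Function using (_∘_; Injective)
open import Relation.Nullary using (does; yes; no)
open import Relation.Unary using (Pred; Decidable)
open import Relation.Unary.Properties using (∁?)
open import Relation.Binary.PropositionalEquality using (_≡_; refl; sym; trans; cong; cong₂; subst; module ≡-Reasoning)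
open import Algebra.Properties.CommutativeMonoid.Sum +-0-commutativeMonoid
  using (sum-syntax; ∑-distrib-+; sum-cong-≗; sum-replicate-zero)

private
  variable
    A B C : Set

δ : ∀ {n} → Fin n → Fin n → ℕ
δ c t = if does (c ≟ t) then 1 else 0

∑-δ : ∀ {n} (c : Fin n) → ∑[ t < n ] δ c t ≡ 1
∑-δ {suc n} Fin.zero    = cong suc (sum-replicate-zero n)
∑-δ         (Fin.suc c) = ∑-δ c   -- does (suc c ≟ suc t) reduces to does (c ≟ t)

sum-tabulate : ∀ {n} (f : Fin n → ℕ) → sum (tabulate f) ≡ ∑[ i < n ] f i
sum-tabulate {0}     f = refl
sum-tabulate {suc n} f = cong (f Fin.zero +_) (sum-tabulate (f ∘ Fin.suc))

sum-map-allFin : ∀ {n} (f : Fin n → ℕ) → sum (map f (allFin n)) ≡ ∑[ i < n ] f i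
sum-map-allFin f = trans (cong sum (map-tabulate (λ i → i) f)) (sum-tabulate f)

module _ {ℓ} {P : Pred A ℓ} (P? : Decidable P) where

  length-filter-∷ : ∀ x xs →
    length (filter P? (x ∷ xs)) ≡ (if does (P? x) then 1 else 0) + length (filter P? xs)
  length-filter-∷ x xs with P? x
  ... | yes _ = refl
  ... | no  _ = refl

  length-filter-+-∁ : ∀ xs → length (filter P? xs) + length (filter (∁? P?) xs) ≡ length xs
  length-filter-+-∁ []       = refl
  length-filter-+-∁ (x ∷ xs) with P? x
  ... | yes _ = cong suc (length-filter-+-∁ xs)
  ... | no  _ = trans (+-suc _ _) (cong suc (length-filter-+-∁ xs))

  sum-map-filter-≤ : ∀ (f : A → ℕ) xs → sum (map f (filter P? xs)) ≤ sum (map f xs)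
  sum-map-filter-≤ f []       = z≤n
  sum-map-filter-≤ f (x ∷ xs) with P? x
  ... | yes _ = +-monoʳ-≤ (f x) (sum-map-filter-≤ f xs)
  ... | no  _ = ≤-trans (sum-map-filter-≤ f xs) (m≤n+m _ (f x))

  count-tabulate : ∀ {n} (f : Fin n → A) → count P? (Vec.tabulate f) ≡ length (filter P? (tabulate f))
  count-tabulate {0}     f = refl
  count-tabulate {suc n} f with P? (f Fin.zero)
  ... | yes _ = cong suc (count-tabulate (f ∘ Fin.suc))
  ... | no  _ = count-tabulate (f ∘ Fin.suc)

fibre : ∀ {n} → (A → Fin n) → Fin n → List A → List A
fibre f t = filter (λ x → f x ≟ t)

∑-length-fibre : ∀ {n} (f : A → Fin n) xs → ∑[ t < n ] length (fibre f t xs) ≡ length xs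
∑-length-fibre {n = n} f []       = sum-replicate-zero n
∑-length-fibre {n = n} f (x ∷ xs) = begin
  ∑[ t < n ] length (fibre f t (x ∷ xs))
    ≡⟨ sum-cong-≗ (λ t → length-filter-∷ (λ y → f y ≟ t) x xs) ⟩
  ∑[ t < n ] (δ (f x) t + length (fibre f t xs))
    ≡⟨ ∑-distrib-+ (δ (f x)) (λ t → length (fibre f t xs)) ⟩
  ∑[ t < n ] δ (f x) t + ∑[ t < n ] length (fibre f t xs)
    ≡⟨ cong₂ _+_ (∑-δ (f x)) (∑-length-fibre f xs) ⟩
  suc (length xs) ∎
  where open ≡-Reasoning

injective-∈⇒≤ : ∀ {q} {xs : List A} (f : Fin q → A) → Injective _≡_ _≡_ f → (∀ j → f j ∈ xs) →
  q ≤ length xs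
injective-∈⇒≤ {xs = xs} f f-injective f∈xs = injective⇒≤ index-injective
  where
  index-injective : Injective _≡_ _≡_ (λ j → index (f∈xs j))
  index-injective {j} {j′} eq = f-injective (begin
    f j                           ≡⟨ lookup-index (f∈xs j) ⟩
    lookup xs (index (f∈xs j))    ≡⟨ cong (lookup xs) eq ⟩
    lookup xs (index (f∈xs j′))   ≡⟨ lookup-index (f∈xs j′) ⟨
    f j′                          ∎)
    where open ≡-Reasoning

length-cartesianProductWith : ∀ (f : A → B → C) xs ys →
  length (cartesianProductWith f xs ys) ≡ length xs * length ys
length-cartesianProductWith f []       ys = refl
length-cartesianProductWith f (x ∷ xs) ys = begin
  length (map (f x) ys List.++ cartesianProductWith f xs ys)
    ≡⟨ length-++ (map (f x) ys) ⟩
  length (map (f x) ys) + length (cartesianProductWith f xs ys)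
    ≡⟨ cong₂ _+_ (length-map (f x) ys) (length-cartesianProductWith f xs ys) ⟩
  length ys + length xs * length ys ∎
  where open ≡-Reasoning

choices : List (List A) → List (List A)
choices []         = [ [] ]
choices (xs ∷ xss) = cartesianProductWith _∷_ xs (choices xss)

length-choices : ∀ (xss : List (List A)) → length (choices xss) ≡ product (map length xss)
length-choices []         = refl
length-choices (xs ∷ xss) =
  trans (length-cartesianProductWith _∷_ xs (choices xss)) (cong (length xs *_) (length-choices xss))

map-∈-choices : ∀ {f : A → B} {S : A → List B} {ts} →
  All (λ t → f t ∈ S t) ts → map f ts ∈ choices (map S ts)
map-∈-choices []             = here refl
map-∈-choices (ft∈St ∷ rest) = ∈-cartesianProductWith⁺ _∷_ ft∈St (map-∈-choices rest)

≡-map⇒All-≡ : ∀ {f g : A → B} xs → map f xs ≡ map g xs → All (λ x → f x ≡ g x) xs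
≡-map⇒All-≡ []       _  = []
≡-map⇒All-≡ (x ∷ xs) eq = proj₁ (∷-injective eq) ∷ ≡-map⇒All-≡ xs (proj₂ (∷-injective eq))

choiceFunctions-≤ : ∀ {q} (S : A → List B) (ts : List A) (F : Fin q → A → B) →
  (∀ j → All (λ t → F j t ∈ S t) ts) →
  (∀ {j j′} → All (λ t → F j t ≡ F j′ t) ts → j ≡ j′) →
  q ≤ product (map (length ∘ S) ts)
choiceFunctions-≤ S ts F F∈S F-injective =
  ≤-trans (injective-∈⇒≤ (λ j → map (F j) ts) (F-injective ∘ ≡-map⇒All-≡ ts) (map-∈-choices ∘ F∈S))
          (≤-reflexive (trans (length-choices (map S ts)) (cong product (sym (map-∘ ts)))))

product-map-const : ∀ (k : ℕ) (xs : List A) → product (map (λ _ → k) xs) ≡ k ^ length xs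
product-map-const k []       = refl
product-map-const k (_ ∷ xs) = cong (k *_) (product-map-const k xs)

foldr-fromList : ∀ (f : A → B → B) e (xs : List A) →
  Vec.foldr (λ _ → B) f e (fromList xs) ≡ List.foldr f e xs
foldr-fromList f e []       = refl
foldr-fromList f e (x ∷ xs) = cong (f x) (foldr-fromList f e xs)

PiGeq-fromList : ∀ {M q} (xs : List ℕ) →
  1 ≤ length xs → All (1 ≤_) xs → sum xs ≤ M → q ≤ product xs → PiGeq (length xs) M q
PiGeq-fromList {M} {q} (x ∷ xs) _ (1≤x ∷ 1≤xs) ∑≤M q≤∏ =
  fromList (x + slack ∷ xs) ,
  VecAll.fromList⁺ (≤-trans 1≤x (m≤m+n x slack) ∷ 1≤xs) ,
  sum-padded ,
  q≤∏-padded
  where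
  slack = M ∸ sum (x ∷ xs)

  sum-padded : sumV (fromList (x + slack ∷ xs)) ≡ M
  sum-padded = begin
    x + slack + sumV (fromList xs)  ≡⟨ cong (x + slack +_) (foldr-fromList _+_ 0 xs) ⟩
    x + slack + sum xs              ≡⟨ +-assoc x slack (sum xs) ⟩
    x + (slack + sum xs)            ≡⟨ cong (x +_) (+-comm slack (sum xs)) ⟩
    x + (sum xs + slack)            ≡⟨ +-assoc x (sum xs) slack ⟨
    sum (x ∷ xs) + slack            ≡⟨ m+[n∸m]≡n ∑≤M ⟩
    M                               ∎
    where open ≡-Reasoning

  q≤∏-padded : q ≤ prod (fromList (x + slack ∷ xs))
  q≤∏-padded = ≤-trans q≤∏ (≤-trans (*-monoˡ-≤ (product xs) (m≤m+n x slack))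
                                     (≤-reflexive (cong ((x + slack) *_) (sym (foldr-fromList _*_ 1 xs)))))

module RectangularBandInT {n p q : ℕ} (φ : Fin p × Fin q → T n)
  (φ-hom : ∀ a b → φ (a ⋆ b) ≈ (φ a · φ b)) (φ-injective : ∀ a b → φ a ≈ φ b → a ≡ b)
  (i₀ : Fin p) (j₀ : Fin q) where

  e : Fin p → Fin q → T n
  e i j = φ (i , j)

  e-∘ : ∀ i j k l x → e k l (e i j x) ≡ e i l x
  e-∘ i j k l x = sym (φ-hom (i , j) (k , l) x)

  h : T n
  h = e i₀ j₀

  image : List (Fin n)
  image = filter (λ y → any? (λ x → h x ≟ y)) (allFin n)

  rank≡length-image : rank h ≡ length image
  rank≡length-image = count-tabulate (λ y → any? (λ x → h x ≟ y)) (λ y → y)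

  h∘h : ∀ x → h (h x) ≡ h x
  h∘h = e-∘ i₀ j₀ i₀ j₀

  h-∈-image : ∀ x → h x ∈ image
  h-∈-image x = ∈-filter⁺ _ (∈-allFin (h x)) (x , refl)

  h-fixes-image : ∀ {t} → t ∈ image → h t ≡ t
  h-fixes-image t∈image
    with proj₂ (∈-filter⁻ (λ y → any? (λ x → h x ≟ y)) {xs = allFin n} t∈image)
  ... | x , refl = h∘h x

  g : Fin p → T n
  g i = e i j₀

  Coincide : Fin n → Set
  Coincide x = ∀ i → g i x ≡ h x

  coincide? : Decidable Coincide
  coincide? x = all? (λ i → g i x ≟ h x)

  coincident spread : List (Fin n)
  coincident = filter coincide? (allFin n)
  spread     = filter (∁? coincide?) (allFin n)

  g-∈-image : ∀ i x → g i x ∈ image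
  g-∈-image i x = subst (_∈ image) (e-∘ i j₀ i₀ j₀ x) (h-∈-image (g i x))

  g-injective-on-spread : ∀ {i i′} → All (λ x → g i x ≡ g i′ x) spread → i ≡ i′
  g-injective-on-spread {i} {i′} agree = cong proj₁ (φ-injective (i , j₀) (i′ , j₀) g-agree)
    where
    g-agree : ∀ x → g i x ≡ g i′ x
    g-agree x with coincide? x
    ... | yes same = trans (same i) (sym (same i′))
    ... | no  ¬same = All.lookup agree (∈-filter⁺ (∁? coincide?) (∈-allFin x) ¬same)

  p≤|image|^|spread| : p ≤ length image ^ length spread
  p≤|image|^|spread| = subst (p ≤_) (product-map-const (length image) spread)
    (choiceFunctions-≤ (λ _ → image) spread g
      (λ i → All.tabulate (λ {x} _ → g-∈-image i x)) g-injective-on-spread)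

  F : Fin n → List (Fin n)
  F t = fibre h t coincident

  c : Fin q → T n
  c j = e i₀ j

  c-∈-F : ∀ j {t} → t ∈ image → c j t ∈ F t
  c-∈-F j {t} t∈image =
    ∈-filter⁺ _ (∈-filter⁺ coincide? (∈-allFin (c j t)) coincides)
      (trans (e-∘ i₀ j i₀ j₀ t) (h-fixes-image t∈image))
    where
    coincides : Coincide (c j t)
    coincides i = trans (e-∘ i₀ j i j₀ t) (sym (e-∘ i₀ j i₀ j₀ t))

  c-injective-on-image : ∀ {j j′} → All (λ t → c j t ≡ c j′ t) image → j ≡ j′
  c-injective-on-image {j} {j′} agree =
    cong proj₂ (φ-injective (i₀ , j) (i₀ , j′) λ x → begin
    c j x        ≡⟨ e-∘ i₀ j₀ i₀ j x ⟨
    c j (h x)    ≡⟨ All.lookup agree (h-∈-image x) ⟩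
    c j′ (h x)   ≡⟨ e-∘ i₀ j₀ i₀ j′ x ⟩
    c j′ x       ∎)
    where open ≡-Reasoning

  q≤∏|F| : q ≤ product (map (length ∘ F) image)
  q≤∏|F| = choiceFunctions-≤ F image c (λ j → All.tabulate (c-∈-F j)) c-injective-on-image

  F-nonempty : All (1 ≤_) (map (length ∘ F) image)
  F-nonempty = map⁺ (All.tabulate (λ t∈image → ∈-length (c-∈-F j₀ t∈image)))

  ∑|F|+|spread|≤n : sum (map (length ∘ F) image) + length spread ≤ n
  ∑|F|+|spread|≤n = begin
    sum (map (length ∘ F) image) + length spread
      ≤⟨ +-monoˡ-≤ (length spread) (sum-map-filter-≤ _ (length ∘ F) (allFin n)) ⟩
    sum (map (length ∘ F) (allFin n)) + length spread
      ≡⟨ cong (_+ length spread) (trans (sum-map-allFin (length ∘ F)) (∑-length-fibre h coincident)) ⟩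
    length coincident + length spread
      ≡⟨ length-filter-+-∁ coincide? (allFin n) ⟩
    length (allFin n)
      ≡⟨ length-tabulate (λ x → x) ⟩
    n ∎
    where open ≤-Reasoning

lemma3p8 : (n r p q : ℕ) → 1 ≤ r → r ≤ n → 2 ≤ p → 2 ≤ q →
    HasRectBand n r p q →
    (l : ℕ) → IsCeilLog r p l → PiGeq r (n ∸ l) q
lemma3p8 n r p q 1≤r _ 2≤p 2≤q (φ , rank≡r , φ-hom , φ-injective) l (_ , l-least) =
  subst (λ k → PiGeq k (n ∸ l) q) |sizes|≡r
    (PiGeq-fromList sizes (subst (1 ≤_) (sym |sizes|≡r) 1≤r) F-nonempty ∑sizes≤n∸l q≤∏|F|)
  where
  i₀ = Fin.fromℕ< (≤-trans (s≤s z≤n) 2≤p)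
  j₀ = Fin.fromℕ< (≤-trans (s≤s z≤n) 2≤q)
  open RectangularBandInT φ φ-hom φ-injective i₀ j₀

  sizes = map (length ∘ F) image

  |image|≡r : length image ≡ r
  |image|≡r = trans (sym rank≡length-image) (rank≡r (i₀ , j₀))

  |sizes|≡r : length sizes ≡ r
  |sizes|≡r = trans (length-map (length ∘ F) image) |image|≡r

  l≤|spread| : l ≤ length spread
  l≤|spread| = l-least (length spread) (subst (λ k → p ≤ k ^ length spread) |image|≡r p≤|image|^|spread|)

  ∑sizes≤n∸l : sum sizes ≤ n ∸ l
  ∑sizes≤n∸l = ≤-trans (m+n≤o⇒m≤o∸n (sum sizes) ∑|F|+|spread|≤n) (∸-monoʳ-≤ n l≤|spread|)
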